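{- Let $A$ and $B$ be connected graphs such that $A \triangleright B$. Then $|V(B)|$ divides $2|V(A)|$. If, moreover, $A$ has no semi-edges, then $|V(B)|$ divides $|V(A)|$.
   Context: A graph has finite vertex and edge sets; every edge is a normal edge (two distinct end-vertices, adding 1 to each degree), a loop (one vertex, adding 2 to its degree) or a semi-edge (one vertex, adding 1 to its degree); multiple loops, semi-edges and parallel edges are allowed. A graph is simple if it has no loops, semi-edges or parallel normal edges. A covering projection from $G$ to a connected graph $H$ is a pair of surjective maps $f_V:V(G)\to V(H)$, $f_E:E(G)\to E(H)$ with $f_V$ degree preserving, $f_E$ mapping semi-edges onto semi-edges and loops onto loops (normal edges may go to normal edges, loops or semi-edges), $f_E$ incidence preserving, and $f_E$ a local bijection between the edge-neighborhoods of each vertex and its image (so the preimage of a loop at $u$ is a disjoint union of cycles spanning $f_V^{ -1}(u)$, the preimage of a semi-edge at $u$ consists of semi-edges and normal edges covering each vertex of $f_V^{ -1}(u)$ exactly once, and the preimage of a normal edge $uv$ is a perfect matching between $f_V^{ -1}(u)$ and $f_V^{ -1}(v)$). $G\longrightarrow H$ means such a projection exists. $A \triangleright B$ means: every simple graph $G$ with $G\longrightarrow A$ satisfies $G\longrightarrow B$. -}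

module Defs where

open import Data.Nat using (ℕ; zero; suc; _+_; _*_; _<_)
open import Data.Fin using (Fin) renaming (zero to fz; suc to fs)
open import Data.Fin.Properties using (_≟_)
open import Data.Product using (Σ; ∃; _×_; _,_)
open import Data.Sum using (_⊎_)
open import Data.Empty using (⊥)
open import Relation.Nullary using (Dec; yes; no; ¬_)
open import Relation.Binary.PropositionalEquality using (_≡_; _≢_)
open import Relation.Binary.Construct.Closure.ReflexiveTransitive using (Star)
open import Function.Definitions using (Surjective)

data Edge (n : ℕ) : Set where
  normal : Fin n → Fin n → Edge n
  loop   : Fin n → Edge n
  semi   : Fin n → Edge n

record Graph : Set where
  field
    nV   : ℕ
    nE   : ℕ
    edge : Fin nE → Edge nV
    normal-distinct : ∀ e x y → edge e ≡ normal x y → x ≢ y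
open Graph public

ind : ∀ {P : Set} → Dec P → ℕ
ind (yes _) = 1
ind (no _)  = 0

sumFin : (m : ℕ) → (Fin m → ℕ) → ℕ
sumFin zero    f = 0
sumFin (suc m) f = f fz + sumFin m (λ i → f (fs i))

mult : ∀ {n} → Edge n → Fin n → ℕ
mult (normal x y) v = ind (x ≟ v) + ind (y ≟ v)
mult (loop x)     v = ind (x ≟ v) + ind (x ≟ v)
mult (semi x)     v = ind (x ≟ v)

deg : (G : Graph) → Fin (nV G) → ℕ
deg G v = sumFin (nE G) (λ e → mult (edge G e) v)

Over : ∀ {n k} → (Fin n → Fin k) → Edge n → Edge k → Set
Over f (normal x y) (normal a b) = (f x ≡ a × f y ≡ b) ⊎ (f x ≡ b × f y ≡ a)
Over f (normal x y) (loop a)     = f x ≡ a × f y ≡ a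
Over f (normal x y) (semi a)     = f x ≡ a × f y ≡ a
Over f (loop x)     (loop a)     = f x ≡ a
Over f (loop x)     _            = ⊥
Over f (semi x)     (semi a)     = f x ≡ a
Over f (semi x)     _            = ⊥

record Covering (G H : Graph) : Set where
  field
    fV : Fin (nV G) → Fin (nV H)
    fE : Fin (nE G) → Fin (nE H)
    fV-surj : Surjective _≡_ _≡_ fV
    fE-surj : Surjective _≡_ _≡_ fE
    deg-pres : ∀ v → deg H (fV v) ≡ deg G v
    inc-pres : ∀ e → Over fV (edge G e) (edge H (fE e))
    -- local bijection on edge-neighbourhoods (counted with multiplicity,
    -- a loop occurring twice in the neighbourhood of its vertex):
    -- for every vertex v of G and every edge h of H, the edges of G
    -- mapped to h occupy exactly as many slots at v as h occupies at fV v.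
    local-bij : ∀ v h →
      sumFin (nE G) (λ e → ind (fE e ≟ h) * mult (edge G e) v)
        ≡ mult (edge H h) (fV v)

_⟶_ : Graph → Graph → Set
G ⟶ H = Covering G H

Simple : Graph → Set
Simple G =
  (∀ e x → edge G e ≢ loop x) ×
  (∀ e x → edge G e ≢ semi x) ×
  (∀ e e' x y → edge G e ≡ normal x y →
     (edge G e' ≡ normal x y ⊎ edge G e' ≡ normal y x) → e ≡ e')

NoSemiEdges : Graph → Set
NoSemiEdges G = ∀ e x → edge G e ≢ semi x

Adj : (G : Graph) → Fin (nV G) → Fin (nV G) → Set
Adj G x y = ∃ λ e → edge G e ≡ normal x y ⊎ edge G e ≡ normal y x

Connected : Graph → Set
Connected G = (0 < nV G) × (∀ x y → Star (Adj G) x y)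

_▷_ : Graph → Graph → Set
A ▷ B = (G : Graph) → Simple G → G ⟶ A → G ⟶ B

module Submission where

-- Over the two ends u, v of a normal edge h of H, a covering G ⟶ H has fibres of the same size:
-- each vertex over u (or v) is an end of exactly one edge over h, and each edge over h has exactly
-- one end over u (and one over v). So all fibres over a connected H agree and |V(H)| divides |V(G)|.
-- Conversely A has many simple covers: replace each vertex x of A by L layers of M columns and lift
-- the i-th edge of A to the edges that advance the column by i + 1 modulo M, staying in the layer for
-- normal edges and loops and passing from the first to the second layer for semi-edges (so L = 2 if
-- A has semi-edges, L = 1 otherwise). Shifts that are distinct, nonzero and have pairwise sums below M
-- make the cover simple. As A ▷ B, |V(B)| divides L·M·|V(A)| and L·(M + 1)·|V(A)|, hence L·|V(A)|.

open import Defs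
open import Data.Nat using (ℕ; zero; suc; _+_; _*_; _∸_; _<_; _≤_; _%_; z≤n; s≤s; NonZero; >-nonZero)
open import Data.Nat.Properties
  using (+-*-semiring; *-commutativeSemigroup; *-zeroʳ; *-identityˡ; *-identityʳ; *-suc;
         *-distribˡ-+; *-comm; *-cancelʳ-≡; +-comm; +-assoc; +-identityʳ; +-mono-≤; suc-injective; <-irrefl;
         ≤-<-trans; <⇒≤; n≤1+n; n<1+n; m≤m+n; m+[n∸m]≡n; m∸n+n≡m)
open import Data.Nat.DivMod using (_mod_; m%n<n; %-distribˡ-+; m%n%n≡m%n; [m+n]%n≡m%n; m<n⇒m%n≡m; %-remove-+ˡ)
open import Data.Nat.Divisibility using (_∣_; ∣-refl; m∣m*n; ∣m+n∣m⇒∣n)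
open import Data.Fin using (Fin; toℕ; fromℕ; fromℕ<; splitAt; _↑ˡ_; _↑ʳ_; combine; remQuot)
  renaming (zero to fz; suc to fs)
open import Data.Fin.Patterns using (0F; 1F)
open import Data.Fin.Properties
  using (_≟_; toℕ-injective; toℕ<n; toℕ-fromℕ<;
         splitAt-↑ˡ; splitAt-↑ʳ; splitAt⁻¹-↑ˡ; splitAt⁻¹-↑ʳ;
         remQuot-combine; combine-remQuot; combine-injective; combine-surjective)
open import Data.Fin.Permutation using (Permutation′; permutation; _⟨$⟩ʳ_; _⟨$⟩ˡ_; inverseˡ; inverseʳ)
import Data.Fin.Permutation as Perm
import Data.Fin.Properties as Fin
open import Data.Product using (Σ; _×_; _,_; proj₁; proj₂)
open import Data.Sum using (_⊎_; inj₁; inj₂; [_,_]′; swap)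
open import Data.Empty using (⊥; ⊥-elim)
open import Function using (_∘_)
open import Relation.Nullary using (Dec; yes; no)
open import Relation.Nullary.Decidable using (_×-dec_)
open import Relation.Binary.PropositionalEquality
open import Relation.Binary.Construct.Closure.ReflexiveTransitive using (Star; ε; _◅_)
open import Algebra.Properties.CommutativeSemigroup *-commutativeSemigroup using (x∙yz≈y∙xz)
open import Algebra.Properties.Semiring.Sum +-*-semiring
  using (sum-syntax; ∑-comm; ∑-distrib-+; *-distribˡ-sum; *-distribʳ-sum; sum-cong-≗; ∑-permute)

open ≡-Reasoning

ind-⇔ : ∀ {P Q : Set} (p : Dec P) (q : Dec Q) → (P → Q) → (Q → P) → ind p ≡ ind q
ind-⇔ (yes _) (yes _) _   _   = refl
ind-⇔ (yes p) (no ¬q) p⇒q _   = ⊥-elim (¬q (p⇒q p))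
ind-⇔ (no ¬p) (yes q) _   q⇒p = ⊥-elim (¬p (q⇒p q))
ind-⇔ (no _)  (no _)  _   _   = refl

ind-×-dec : ∀ {P Q : Set} (p : Dec P) (q : Dec Q) → ind (p ×-dec q) ≡ ind p * ind q
ind-×-dec (yes _) (yes _) = refl
ind-×-dec (yes _) (no _)  = refl
ind-×-dec (no _)  _       = refl

ind-sym : ∀ {n} (i j : Fin n) → ind (i ≟ j) ≡ ind (j ≟ i)
ind-sym i j = ind-⇔ (i ≟ j) (j ≟ i) sym sym

ind-combine : ∀ {m n} (x a : Fin m) (p q : Fin n) →
  ind (combine x p ≟ combine a q) ≡ ind (x ≟ a) * ind (p ≟ q)
ind-combine x a p q = begin
  ind (combine x p ≟ combine a q)    ≡⟨ ind-⇔ _ (x ≟ a ×-dec p ≟ q) (combine-injective x p a q) same ⟩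
  ind (x ≟ a ×-dec p ≟ q)            ≡⟨ ind-×-dec (x ≟ a) (p ≟ q) ⟩
  ind (x ≟ a) * ind (p ≟ q)          ∎
  where
  same : x ≡ a × p ≡ q → combine x p ≡ combine a q
  same (refl , refl) = refl

ind-subst : ∀ {n} (w u : Fin n) (g : Fin n → ℕ) → ind (w ≟ u) * g w ≡ ind (w ≟ u) * g u
ind-subst w u g with w ≟ u
... | yes refl = refl
... | no _     = refl

*-cancel-one : ∀ {a b m} → m ≡ 1 → a * m ≡ b * m → a ≡ b
*-cancel-one {a} {b} refl = *-cancelʳ-≡ a b 1

sumFin≡∑ : ∀ m (f : Fin m → ℕ) → sumFin m f ≡ ∑[ i < m ] f i
sumFin≡∑ zero    f = refl
sumFin≡∑ (suc m) f = cong (f fz +_) (sumFin≡∑ m (f ∘ fs))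

∑-const : ∀ n c → ∑[ i < n ] c ≡ n * c
∑-const zero    c = refl
∑-const (suc n) c = cong (c +_) (∑-const n c)

∑-++ : ∀ a b (g : Fin (a + b) → ℕ) →
  ∑[ t < a + b ] g t ≡ ∑[ i < a ] g (i ↑ˡ b) + ∑[ j < b ] g (a ↑ʳ j)
∑-++ zero    b g = refl
∑-++ (suc a) b g = trans (cong (g fz +_) (∑-++ a b (g ∘ fs))) (sym (+-assoc (g fz) _ _))

∑-ind : ∀ {n} (c : Fin n) → ∑[ i < n ] ind (i ≟ c) ≡ 1
∑-ind {suc n} fz     = cong suc (trans (∑-const n 0) (*-zeroʳ n))
∑-ind {suc n} (fs c) =
  trans (sum-cong-≗ (λ i → ind-⇔ (fs i ≟ fs c) (i ≟ c) Fin.suc-injective (cong fs))) (∑-ind c)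

∑-ind′ : ∀ {n} (c : Fin n) → ∑[ i < n ] ind (c ≟ i) ≡ 1
∑-ind′ c = trans (sum-cong-≗ (λ i → ind-sym c i)) (∑-ind c)

∑-δ : ∀ {n} (c : Fin n) (g : Fin n → ℕ) → ∑[ i < n ] (ind (i ≟ c) * g i) ≡ g c
∑-δ {n} c g = begin
  ∑[ i < n ] (ind (i ≟ c) * g i)   ≡⟨ sum-cong-≗ (λ i → ind-subst i c g) ⟩
  ∑[ i < n ] (ind (i ≟ c) * g c)   ≡⟨ *-distribʳ-sum (g c) (λ i → ind (i ≟ c)) ⟨
  ∑[ i < n ] ind (i ≟ c) * g c     ≡⟨ cong (_* g c) (∑-ind c) ⟩
  1 * g c                          ≡⟨ *-identityˡ (g c) ⟩
  g c                              ∎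

∑-ind-permute : ∀ {n} (π : Permutation′ n) (q : Fin n) → ∑[ j < n ] ind (π ⟨$⟩ʳ j ≟ q) ≡ 1
∑-ind-permute π q = trans (sym (∑-permute (λ i → ind (i ≟ q)) π)) (∑-ind q)

∑-ind-combine : ∀ {m n} (π : Permutation′ n) (x a : Fin m) (q : Fin n) →
  ∑[ j < n ] ind (combine x (π ⟨$⟩ʳ j) ≟ combine a q) ≡ ind (x ≟ a)
∑-ind-combine {n = n} π x a q = begin
  ∑[ j < n ] ind (combine x (π ⟨$⟩ʳ j) ≟ combine a q)
    ≡⟨ sum-cong-≗ (λ j → ind-combine x a (π ⟨$⟩ʳ j) q) ⟩
  ∑[ j < n ] (ind (x ≟ a) * ind (π ⟨$⟩ʳ j ≟ q))
    ≡⟨ *-distribˡ-sum (ind (x ≟ a)) (λ j → ind (π ⟨$⟩ʳ j ≟ q)) ⟨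
  ind (x ≟ a) * ∑[ j < n ] ind (π ⟨$⟩ʳ j ≟ q)
    ≡⟨ cong (ind (x ≟ a) *_) (∑-ind-permute π q) ⟩
  ind (x ≟ a) * 1
    ≡⟨ *-identityʳ _ ⟩
  ind (x ≟ a)
    ∎

∑-ind-combine² : ∀ {m n k} (ρ : Permutation′ k) (x a : Fin m) (β γ : Fin n) (i : Fin k) →
  ∑[ j < k ] ind (combine x (combine β (ρ ⟨$⟩ʳ j)) ≟ combine a (combine γ i)) ≡ ind (x ≟ a) * ind (β ≟ γ)
∑-ind-combine² {k = k} ρ x a β γ i = begin
  ∑[ j < k ] ind (combine x (combine β (ρ ⟨$⟩ʳ j)) ≟ combine a (combine γ i))
    ≡⟨ sum-cong-≗ (λ j → ind-combine x a (combine β (ρ ⟨$⟩ʳ j)) (combine γ i)) ⟩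
  ∑[ j < k ] (ind (x ≟ a) * ind (combine β (ρ ⟨$⟩ʳ j) ≟ combine γ i))
    ≡⟨ *-distribˡ-sum (ind (x ≟ a)) (λ j → ind (combine β (ρ ⟨$⟩ʳ j) ≟ combine γ i)) ⟨
  ind (x ≟ a) * ∑[ j < k ] ind (combine β (ρ ⟨$⟩ʳ j) ≟ combine γ i)
    ≡⟨ cong (ind (x ≟ a) *_) (∑-ind-combine ρ β γ i) ⟩
  ind (x ≟ a) * ind (β ≟ γ)
    ∎

toΣ : ∀ {m} (f : Fin m → ℕ) → Fin (sumFin m f) → Σ (Fin m) (Fin ∘ f)
toΣ {suc m} f t = [ (fz ,_) , there ]′ (splitAt (f fz) t)
  where
  there : Fin (sumFin m (f ∘ fs)) → Σ (Fin (suc m)) (Fin ∘ f)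
  there t′ = fs (proj₁ (toΣ (f ∘ fs) t′)) , proj₂ (toΣ (f ∘ fs) t′)

fromΣ : ∀ {m} (f : Fin m → ℕ) → Σ (Fin m) (Fin ∘ f) → Fin (sumFin m f)
fromΣ {suc m} f (fz   , j) = j ↑ˡ sumFin m (f ∘ fs)
fromΣ {suc m} f (fs i , j) = f fz ↑ʳ fromΣ (f ∘ fs) (i , j)

toΣ-↑ˡ : ∀ {m} (f : Fin (suc m) → ℕ) j → toΣ f (j ↑ˡ sumFin m (f ∘ fs)) ≡ (fz , j)
toΣ-↑ˡ {m} f j rewrite splitAt-↑ˡ (f fz) j (sumFin m (f ∘ fs)) = refl

toΣ-↑ʳ : ∀ {m} (f : Fin (suc m) → ℕ) t →
  toΣ f (f fz ↑ʳ t) ≡ (fs (proj₁ (toΣ (f ∘ fs) t)) , proj₂ (toΣ (f ∘ fs) t))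
toΣ-↑ʳ {m} f t rewrite splitAt-↑ʳ (f fz) (sumFin m (f ∘ fs)) t = refl

toΣ-fromΣ : ∀ {m} (f : Fin m → ℕ) p → toΣ f (fromΣ f p) ≡ p
toΣ-fromΣ {suc m} f (fz   , j) = toΣ-↑ˡ f j
toΣ-fromΣ {suc m} f (fs i , j) rewrite toΣ-↑ʳ f (fromΣ (f ∘ fs) (i , j)) | toΣ-fromΣ (f ∘ fs) (i , j) = refl

fromΣ-toΣ : ∀ {m} (f : Fin m → ℕ) t → fromΣ f (toΣ f t) ≡ t
fromΣ-toΣ {suc m} f t with splitAt (f fz) t in eq
... | inj₁ j  = splitAt⁻¹-↑ˡ eq
... | inj₂ t′ = trans (cong (f fz ↑ʳ_) (fromΣ-toΣ (f ∘ fs) t′)) (splitAt⁻¹-↑ʳ eq)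

toΣ-injective : ∀ {m} (f : Fin m → ℕ) {t t′} → toΣ f t ≡ toΣ f t′ → t ≡ t′
toΣ-injective f {t} {t′} eq = trans (sym (fromΣ-toΣ f t)) (trans (cong (fromΣ f) eq) (fromΣ-toΣ f t′))

∑-toΣ : ∀ {m} (f : Fin m → ℕ) (g : Σ (Fin m) (Fin ∘ f) → ℕ) →
  ∑[ t < sumFin m f ] g (toΣ f t) ≡ ∑[ i < m ] ∑[ j < f i ] g (i , j)
∑-toΣ {zero}  f g = refl
∑-toΣ {suc m} f g = begin
  ∑[ t < sumFin (suc m) f ] g (toΣ f t)
    ≡⟨ ∑-++ (f fz) _ (g ∘ toΣ f) ⟩
  ∑[ j < f fz ] g (toΣ f (j ↑ˡ _)) + ∑[ t < sumFin m (f ∘ fs) ] g (toΣ f (f fz ↑ʳ t))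
    ≡⟨ cong₂ _+_ (sum-cong-≗ (cong g ∘ toΣ-↑ˡ f)) (sum-cong-≗ (cong g ∘ toΣ-↑ʳ f)) ⟩
  ∑[ j < f fz ] g (fz , j) + ∑[ t < sumFin m (f ∘ fs) ] g′ (toΣ (f ∘ fs) t)
    ≡⟨ cong (∑[ j < f fz ] g (fz , j) +_) (∑-toΣ (f ∘ fs) g′) ⟩
  ∑[ i < suc m ] ∑[ j < f i ] g (i , j)
    ∎
  where
  g′ : Σ (Fin m) (Fin ∘ f ∘ fs) → ℕ
  g′ (i , j) = g (fs i , j)

ends : ∀ {n} → Edge n → Fin n × Fin n
ends (normal x y) = x , y
ends (loop x)     = x , x
ends (semi x)     = x , x

normal-injective : ∀ {n} {a b c d : Fin n} → normal a b ≡ normal c d → a ≡ c × b ≡ d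
normal-injective refl = refl , refl

mult-tail : ∀ {n} {u v : Fin n} → u ≢ v → mult (normal u v) u ≡ 1
mult-tail {u = u} {v} u≢v with u ≟ u | v ≟ u
... | yes _   | no _     = refl
... | yes _   | yes refl = ⊥-elim (u≢v refl)
... | no u≢u  | _        = ⊥-elim (u≢u refl)

mult-head : ∀ {n} {u v : Fin n} → v ≢ u → mult (normal v u) u ≡ 1
mult-head {u = u} {v} v≢u = trans (+-comm (ind (v ≟ u)) _) (mult-tail (v≢u ∘ sym))

∑-mult-normal : ∀ {m} (g : Fin m → ℕ) (y z : Fin m) → ∑[ x < m ] (g x * mult (normal y z) x) ≡ g y + g z
∑-mult-normal {m} g y z = begin
  ∑[ x < m ] (g x * (ind (y ≟ x) + ind (z ≟ x)))
    ≡⟨ sum-cong-≗ split ⟩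
  ∑[ x < m ] (ind (x ≟ y) * g x + ind (x ≟ z) * g x)
    ≡⟨ ∑-distrib-+ (λ x → ind (x ≟ y) * g x) _ ⟩
  ∑[ x < m ] (ind (x ≟ y) * g x) + ∑[ x < m ] (ind (x ≟ z) * g x)
    ≡⟨ cong₂ _+_ (∑-δ y g) (∑-δ z g) ⟩
  g y + g z
    ∎
  where
  split : ∀ x → g x * (ind (y ≟ x) + ind (z ≟ x)) ≡ ind (x ≟ y) * g x + ind (x ≟ z) * g x
  split x rewrite ind-sym y x | ind-sym z x = trans (*-distribˡ-+ (g x) (ind (x ≟ y)) (ind (x ≟ z)))
    (cong₂ _+_ (*-comm (g x) (ind (x ≟ y))) (*-comm (g x) (ind (x ≟ z))))

∑-ind-mult-over : ∀ {m n} (f : Fin m → Fin n) (E : Edge m) {a b : Fin n} (u : Fin n) →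
  Over f E (normal a b) → ∑[ x < m ] (ind (f x ≟ u) * mult E x) ≡ mult (normal a b) u
∑-ind-mult-over f (normal y z) u over = trans (∑-mult-normal (λ x → ind (f x ≟ u)) y z) (ends-in-fibre over)
  where
  ends-in-fibre : ∀ {a b} → Over f (normal y z) (normal a b) → ind (f y ≟ u) + ind (f z ≟ u) ≡ mult (normal a b) u
  ends-in-fibre (inj₁ (refl , refl)) = refl
  ends-in-fibre (inj₂ (refl , refl)) = +-comm (ind (f y ≟ u)) _
∑-ind-mult-over f (loop _) u ()
∑-ind-mult-over f (semi _) u ()

LocallyBijective : (G H : Graph) → (Fin (nV G) → Fin (nV H)) → (Fin (nE G) → Fin (nE H)) → Set
LocallyBijective G H fV fE = ∀ v h →
  sumFin (nE G) (λ e → ind (fE e ≟ h) * mult (edge G e) v) ≡ mult (edge H h) (fV v)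

locallyBijective⇒deg-pres : ∀ G H fV fE → LocallyBijective G H fV fE → ∀ v → deg H (fV v) ≡ deg G v
locallyBijective⇒deg-pres G H fV fE local-bij v = begin
  deg H (fV v)                                                       ≡⟨ sumFin≡∑ (nE H) _ ⟩
  ∑[ h < nE H ] mult (edge H h) (fV v)
    ≡⟨ sum-cong-≗ (λ h → trans (sym (local-bij v h)) (sumFin≡∑ (nE G) _)) ⟩
  ∑[ h < nE H ] ∑[ e < nE G ] (ind (fE e ≟ h) * mult (edge G e) v)
    ≡⟨ ∑-comm (λ h e → ind (fE e ≟ h) * mult (edge G e) v) ⟩
  ∑[ e < nE G ] ∑[ h < nE H ] (ind (fE e ≟ h) * mult (edge G e) v)
    ≡⟨ sum-cong-≗ (λ e → *-distribʳ-sum (mult (edge G e) v) (λ h → ind (fE e ≟ h))) ⟨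
  ∑[ e < nE G ] (∑[ h < nE H ] ind (fE e ≟ h) * mult (edge G e) v)
    ≡⟨ sum-cong-≗ (λ e → trans (cong (_* mult (edge G e) v) (∑-ind′ (fE e))) (*-identityˡ _)) ⟩
  ∑[ e < nE G ] mult (edge G e) v                                    ≡⟨ sumFin≡∑ (nE G) _ ⟨
  deg G v                                                            ∎

module Fibres {G H : Graph} (C : G ⟶ H) where
  open Covering C

  fibre : Fin (nV H) → ℕ
  fibre u = ∑[ x < nV G ] ind (fV x ≟ u)

  edgesOver : Fin (nE H) → ℕ
  edgesOver h = ∑[ e < nE G ] ind (fE e ≟ h)

  nV≡∑fibre : nV G ≡ ∑[ u < nV H ] fibre u
  nV≡∑fibre = begin
    nV G                                        ≡⟨ *-identityʳ (nV G) ⟨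
    nV G * 1                                    ≡⟨ ∑-const (nV G) 1 ⟨
    ∑[ x < nV G ] 1                             ≡⟨ sum-cong-≗ (∑-ind′ ∘ fV) ⟨
    ∑[ x < nV G ] ∑[ u < nV H ] ind (fV x ≟ u)  ≡⟨ ∑-comm (λ x u → ind (fV x ≟ u)) ⟩
    ∑[ u < nV H ] fibre u                       ∎

  private
    ends-over : ∀ u h {a b} → edge H h ≡ normal a b → ∀ e →
      ind (fE e ≟ h) * ∑[ x < nV G ] (ind (fV x ≟ u) * mult (edge G e) x) ≡ ind (fE e ≟ h) * mult (edge H h) u
    ends-over u h eq e with fE e ≟ h | inc-pres e
    ... | no _     | _    = refl
    ... | yes refl | over rewrite eq = cong (1 *_) (∑-ind-mult-over fV (edge G e) u over)

  -- Both sides count the ends over u of edges over h, by vertex (local bijectivity) and by edge.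
  fibre-double-count : ∀ u h {a b} → edge H h ≡ normal a b →
    fibre u * mult (edge H h) u ≡ edgesOver h * mult (edge H h) u
  fibre-double-count u h eq = begin
    fibre u * m
      ≡⟨ *-distribʳ-sum m (λ x → ind (fV x ≟ u)) ⟩
    ∑[ x < nV G ] (ind (fV x ≟ u) * m)
      ≡⟨ sum-cong-≗ (λ x → ind-subst (fV x) u (mult (edge H h))) ⟨
    ∑[ x < nV G ] (ind (fV x ≟ u) * mult (edge H h) (fV x))
      ≡⟨ sum-cong-≗ (λ x → cong (ind (fV x ≟ u) *_) (trans (sym (local-bij x h)) (sumFin≡∑ (nE G) _))) ⟩
    ∑[ x < nV G ] (ind (fV x ≟ u) * ∑[ e < nE G ] (ind (fE e ≟ h) * mult (edge G e) x))
      ≡⟨ sum-cong-≗ (λ x → *-distribˡ-sum (ind (fV x ≟ u)) (λ e → ind (fE e ≟ h) * mult (edge G e) x)) ⟩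
    ∑[ x < nV G ] ∑[ e < nE G ] (ind (fV x ≟ u) * (ind (fE e ≟ h) * mult (edge G e) x))
      ≡⟨ ∑-comm (λ x e → ind (fV x ≟ u) * (ind (fE e ≟ h) * mult (edge G e) x)) ⟩
    ∑[ e < nE G ] ∑[ x < nV G ] (ind (fV x ≟ u) * (ind (fE e ≟ h) * mult (edge G e) x))
      ≡⟨ sum-cong-≗ (λ e → trans (sum-cong-≗ (λ x → x∙yz≈y∙xz (ind (fV x ≟ u)) (ind (fE e ≟ h)) _))
             (sym (*-distribˡ-sum (ind (fE e ≟ h)) (λ x → ind (fV x ≟ u) * mult (edge G e) x)))) ⟩
    ∑[ e < nE G ] (ind (fE e ≟ h) * ∑[ x < nV G ] (ind (fV x ≟ u) * mult (edge G e) x))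
      ≡⟨ sum-cong-≗ (ends-over u h eq) ⟩
    ∑[ e < nE G ] (ind (fE e ≟ h) * m)
      ≡⟨ *-distribʳ-sum m (λ e → ind (fE e ≟ h)) ⟨
    edgesOver h * m
      ∎
    where m = mult (edge H h) u

  fibre-end : ∀ h u v → edge H h ≡ normal u v ⊎ edge H h ≡ normal v u → fibre u ≡ edgesOver h
  fibre-end h u v (inj₁ eq) =
    *-cancel-one (trans (cong (λ F → mult F u) eq) (mult-tail (normal-distinct H h u v eq)))
                 (fibre-double-count u h eq)
  fibre-end h u v (inj₂ eq) =
    *-cancel-one (trans (cong (λ F → mult F u) eq) (mult-head (normal-distinct H h v u eq)))
                 (fibre-double-count u h eq)

  fibre-adjacent : ∀ {u v} → Adj H u v → fibre u ≡ fibre v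
  fibre-adjacent {u} {v} (h , end) = trans (fibre-end h u v end) (sym (fibre-end h v u (swap end)))

  fibre-walk : ∀ {u v} → Star (Adj H) u v → fibre u ≡ fibre v
  fibre-walk ε       = refl
  fibre-walk (a ◅ w) = trans (fibre-adjacent a) (fibre-walk w)

nV∣nV-of-covering : ∀ {G H} → Connected H → G ⟶ H → nV H ∣ nV G
nV∣nV-of-covering {G} {H} (0<nV , walk) C = subst (nV H ∣_) (sym nV≡nV*fibre) (m∣m*n (fibre u₀))
  where
  open Fibres C
  u₀ : Fin (nV H)
  u₀ = fromℕ< 0<nV
  nV≡nV*fibre : nV G ≡ nV H * fibre u₀
  nV≡nV*fibre = begin
    nV G                      ≡⟨ nV≡∑fibre ⟩
    ∑[ u < nV H ] fibre u     ≡⟨ sum-cong-≗ (λ u → fibre-walk (walk u u₀)) ⟩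
    ∑[ u < nV H ] fibre u₀    ≡⟨ ∑-const (nV H) (fibre u₀) ⟩
    nV H * fibre u₀           ∎

module Rotation (M : ℕ) .{{_ : NonZero M}} where

  infixl 6 _⊕_
  _⊕_ : Fin M → ℕ → Fin M
  k ⊕ s = (toℕ k + s) mod M

  toℕ-⊕ : ∀ k s → toℕ (k ⊕ s) ≡ (toℕ k + s) % M
  toℕ-⊕ k s = toℕ-fromℕ< (m%n<n (toℕ k + s) M)

  ⊕-assoc : ∀ k s t → k ⊕ s ⊕ t ≡ k ⊕ (s + t)
  ⊕-assoc k s t = toℕ-injective (begin
    toℕ (k ⊕ s ⊕ t)                   ≡⟨ toℕ-⊕ (k ⊕ s) t ⟩
    (toℕ (k ⊕ s) + t) % M             ≡⟨ cong (λ n → (n + t) % M) (toℕ-⊕ k s) ⟩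
    ((toℕ k + s) % M + t) % M         ≡⟨ %-distribˡ-+ ((toℕ k + s) % M) t M ⟩
    ((toℕ k + s) % M % M + t % M) % M ≡⟨ cong (λ n → (n + t % M) % M) (m%n%n≡m%n (toℕ k + s) M) ⟩
    ((toℕ k + s) % M + t % M) % M     ≡⟨ %-distribˡ-+ (toℕ k + s) t M ⟨
    (toℕ k + s + t) % M               ≡⟨ cong (_% M) (+-assoc (toℕ k) s t) ⟩
    (toℕ k + (s + t)) % M             ≡⟨ toℕ-⊕ k (s + t) ⟨
    toℕ (k ⊕ (s + t))                 ∎)

  ⊕-identityʳ : ∀ k → k ⊕ 0 ≡ k
  ⊕-identityʳ k = toℕ-injective (begin
    toℕ (k ⊕ 0)        ≡⟨ toℕ-⊕ k 0 ⟩
    (toℕ k + 0) % M    ≡⟨ cong (_% M) (+-identityʳ (toℕ k)) ⟩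
    toℕ k % M          ≡⟨ m<n⇒m%n≡m (toℕ<n k) ⟩
    toℕ k              ∎)

  ⊕-period : ∀ k → k ⊕ M ≡ k
  ⊕-period k = toℕ-injective (begin
    toℕ (k ⊕ M)        ≡⟨ toℕ-⊕ k M ⟩
    (toℕ k + M) % M    ≡⟨ [m+n]%n≡m%n (toℕ k) M ⟩
    toℕ k % M          ≡⟨ m<n⇒m%n≡m (toℕ<n k) ⟩
    toℕ k              ∎)

  ⊕-unrotate : ∀ k s → toℕ (k ⊕ s ⊕ (M ∸ toℕ k)) ≡ s % M
  ⊕-unrotate k s = begin
    toℕ (k ⊕ s ⊕ (M ∸ toℕ k))           ≡⟨ cong toℕ (⊕-assoc k s (M ∸ toℕ k)) ⟩
    toℕ (k ⊕ (s + (M ∸ toℕ k)))         ≡⟨ toℕ-⊕ k (s + (M ∸ toℕ k)) ⟩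
    (toℕ k + (s + (M ∸ toℕ k))) % M     ≡⟨ cong (λ n → (toℕ k + n) % M) (+-comm s (M ∸ toℕ k)) ⟩
    (toℕ k + ((M ∸ toℕ k) + s)) % M     ≡⟨ cong (_% M) (+-assoc (toℕ k) (M ∸ toℕ k) s) ⟨
    (toℕ k + (M ∸ toℕ k) + s) % M       ≡⟨ cong (λ n → (n + s) % M) (m+[n∸m]≡n (<⇒≤ (toℕ<n k))) ⟩
    (M + s) % M                         ≡⟨ %-remove-+ˡ s ∣-refl ⟩
    s % M                               ∎

  ⊕-cancelˡ : ∀ k {s t} → s < M → t < M → k ⊕ s ≡ k ⊕ t → s ≡ t
  ⊕-cancelˡ k {s} {t} s<M t<M eq = begin
    s                          ≡⟨ m<n⇒m%n≡m s<M ⟨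
    s % M                      ≡⟨ ⊕-unrotate k s ⟨
    toℕ (k ⊕ s ⊕ (M ∸ toℕ k))  ≡⟨ cong (λ i → toℕ (i ⊕ (M ∸ toℕ k))) eq ⟩
    toℕ (k ⊕ t ⊕ (M ∸ toℕ k))  ≡⟨ ⊕-unrotate k t ⟩
    t % M                      ≡⟨ m<n⇒m%n≡m t<M ⟩
    t                          ∎

  ⊕-fixedPointFree : ∀ k {s} → 0 < s → s < M → k ⊕ s ≢ k
  ⊕-fixedPointFree k {s} 0<s s<M eq with ⊕-cancelˡ k s<M (≤-<-trans z≤n s<M) (trans eq (sym (⊕-identityʳ k)))
  ... | refl = <-irrefl refl 0<s

  rotation : ∀ s → s ≤ M → Permutation′ M
  rotation s s≤M = permutation (_⊕ s) (_⊕ (M ∸ s)) forth back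
    where
    forth : ∀ k → k ⊕ (M ∸ s) ⊕ s ≡ k
    forth k = trans (⊕-assoc k (M ∸ s) s) (trans (cong (k ⊕_) (m∸n+n≡m s≤M)) (⊕-period k))
    back : ∀ k → k ⊕ s ⊕ (M ∸ s) ≡ k
    back k = trans (⊕-assoc k s (M ∸ s)) (trans (cong (k ⊕_) (m+[n∸m]≡n s≤M)) (⊕-period k))

columnwise : ∀ {L M} → Permutation′ M → Permutation′ (L * M)
columnwise {L} {M} ρ = permutation (act (ρ ⟨$⟩ʳ_)) (act (ρ ⟨$⟩ˡ_))
  (act-inverse {ρ ⟨$⟩ʳ_} {ρ ⟨$⟩ˡ_} (inverseʳ ρ)) (act-inverse {ρ ⟨$⟩ˡ_} {ρ ⟨$⟩ʳ_} (inverseˡ ρ))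
  where
  act : (Fin M → Fin M) → Fin (L * M) → Fin (L * M)
  act f p = combine (proj₁ (remQuot {L} M p)) (f (proj₂ (remQuot {L} M p)))
  act-inverse : ∀ {f g} → (∀ {k} → f (g k) ≡ k) → ∀ p → act f (act g p) ≡ p
  act-inverse {f} {g} fg p = begin
    act f (act g p)      ≡⟨ cong (λ (β , k) → combine β (f k)) (remQuot-combine {L} β (g k)) ⟩
    combine β (f (g k))  ≡⟨ cong (combine β) fg ⟩
    combine β k          ≡⟨ combine-remQuot {L} M p ⟩
    p                    ∎
    where
    β = proj₁ (remQuot {L} M p)
    k = proj₂ (remQuot {L} M p)

ind-fz+ind-fromℕ≡1 : ∀ {L′} → L′ ≡ 1 → (γ : Fin (suc L′)) →
  ind (fz ≟ γ) + ind (fromℕ L′ ≟ γ) ≡ 1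
ind-fz+ind-fromℕ≡1 refl 0F = refl
ind-fz+ind-fromℕ≡1 refl 1F = refl

module SimpleCover (A : Graph) (L′ M : ℕ) (2e<M : nE A + nE A < M)
                   (semi⇒L′≡1 : ∀ e x → edge A e ≡ semi x → L′ ≡ 1) where

  L : ℕ
  L = suc L′

  instance
    M-nonZero : NonZero M
    M-nonZero = >-nonZero (≤-<-trans z≤n 2e<M)

  open Rotation M

  layer : Fin (L * M) → Fin L
  layer p = proj₁ (remQuot {L} M p)

  column : Fin (L * M) → Fin M
  column p = proj₂ (remQuot {L} M p)

  column-combine : ∀ β k → column (combine β k) ≡ k
  column-combine β k = cong proj₂ (remQuot-combine β k)

  -- The vertex combine x (combine β k) of G lies over x, in layer β and column k. Semi-edges lift
  -- to edges from layer bottom to layer top, which are distinct when L′ ≡ 1.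
  bottom top : Fin L
  bottom = fz
  top    = fromℕ L′

  shift : Fin (nE A) → ℕ
  shift e = suc (toℕ e)

  shift-injective : ∀ {e e′} → shift e ≡ shift e′ → e ≡ e′
  shift-injective = toℕ-injective ∘ suc-injective

  shift+shift<M : ∀ e e′ → shift e + shift e′ < M
  shift+shift<M e e′ = ≤-<-trans (+-mono-≤ (toℕ<n e) (toℕ<n e′)) 2e<M

  shift<M : ∀ e → shift e < M
  shift<M e = ≤-<-trans (m≤m+n (shift e) (shift e)) (shift+shift<M e e)

  shiftColumn : ℕ → Fin (L * M) → Fin (L * M)
  shiftColumn s p = combine (layer p) (column p ⊕ s)

  lifts : Edge (nV A) → ℕ
  lifts (normal _ _) = L * M
  lifts (loop _)     = L * M
  lifts (semi _)     = M

  tailPos : (E : Edge (nV A)) → Fin (lifts E) → Fin (L * M)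
  tailPos (normal _ _) j = j
  tailPos (loop _)     j = j
  tailPos (semi _)     k = combine bottom k

  headPos : (E : Edge (nV A)) → ℕ → Fin (lifts E) → Fin (L * M)
  headPos (normal _ _) s j = shiftColumn s j
  headPos (loop _)     s j = shiftColumn s j
  headPos (semi _)     s k = combine top (k ⊕ s)

  liftEdge : (E : Edge (nV A)) → ℕ → Fin (lifts E) → Edge (nV A * (L * M))
  liftEdge E s j = normal (combine (proj₁ (ends E)) (tailPos E j)) (combine (proj₂ (ends E)) (headPos E s j))

  column-headPos : ∀ E s j → column (headPos E s j) ≡ column (tailPos E j) ⊕ s
  column-headPos (normal _ _) s j = column-combine (layer j) (column j ⊕ s)
  column-headPos (loop _)     s j = column-combine (layer j) (column j ⊕ s)
  column-headPos (semi _)     s k = trans (column-combine top (k ⊕ s)) (cong (_⊕ s) (sym (column-combine bottom k)))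

  tailPos-injective : ∀ E {j j′} → tailPos E j ≡ tailPos E j′ → j ≡ j′
  tailPos-injective (normal _ _) eq = eq
  tailPos-injective (loop _)     eq = eq
  tailPos-injective (semi _) {k} {k′} eq = proj₂ (combine-injective bottom k bottom k′ eq)

  ∑-mult-shifted : ∀ (x y : Fin (nV A)) s → s ≤ M → ∀ a (q : Fin (L * M)) →
    ∑[ j < L * M ] (ind (combine x j ≟ combine a q) + ind (combine y (shiftColumn s j) ≟ combine a q))
      ≡ ind (x ≟ a) + ind (y ≟ a)
  ∑-mult-shifted x y s s≤M a q =
    trans (∑-distrib-+ (λ j → ind (combine x j ≟ combine a q))
                       (λ j → ind (combine y (shiftColumn s j) ≟ combine a q)))
          (cong₂ _+_ (∑-ind-combine Perm.id x a q) (∑-ind-combine (columnwise {L} (rotation s s≤M)) y a q))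

  ∑-mult-liftEdge : ∀ E s → s ≤ M → (∀ x → E ≡ semi x → L′ ≡ 1) →
    ∀ a (γ : Fin L) (i : Fin M) →
    ∑[ j < lifts E ] mult (liftEdge E s j) (combine a (combine γ i)) ≡ mult E a
  ∑-mult-liftEdge (normal x y) s s≤M _ a γ i = ∑-mult-shifted x y s s≤M a (combine γ i)
  ∑-mult-liftEdge (loop x)     s s≤M _ a γ i = ∑-mult-shifted x x s s≤M a (combine γ i)
  ∑-mult-liftEdge (semi x)     s s≤M L′≡1 a γ i = begin
    ∑[ k < M ] (ind (combine x (combine bottom k) ≟ v) + ind (combine x (combine top (k ⊕ s)) ≟ v))
      ≡⟨ ∑-distrib-+ (λ k → ind (combine x (combine bottom k) ≟ v))
                     (λ k → ind (combine x (combine top (k ⊕ s)) ≟ v)) ⟩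
    ∑[ k < M ] ind (combine x (combine bottom k) ≟ v) + ∑[ k < M ] ind (combine x (combine top (k ⊕ s)) ≟ v)
      ≡⟨ cong₂ _+_ (∑-ind-combine² Perm.id x a bottom γ i) (∑-ind-combine² (rotation s s≤M) x a top γ i) ⟩
    ind (x ≟ a) * ind (bottom ≟ γ) + ind (x ≟ a) * ind (top ≟ γ)
      ≡⟨ *-distribˡ-+ (ind (x ≟ a)) (ind (bottom ≟ γ)) _ ⟨
    ind (x ≟ a) * (ind (bottom ≟ γ) + ind (top ≟ γ))
      ≡⟨ cong (ind (x ≟ a) *_) (ind-fz+ind-fromℕ≡1 (L′≡1 x refl) γ) ⟩
    ind (x ≟ a) * 1
      ≡⟨ *-identityʳ _ ⟩
    ind (x ≟ a)
      ∎
    where v = combine a (combine γ i)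

  Lift : Set
  Lift = Σ (Fin (nE A)) (λ e → Fin (lifts (edge A e)))

  liftOf : Lift → Edge (nV A * (L * M))
  liftOf (e , j) = liftEdge (edge A e) (shift e) j

  columnOf : Fin (nV A * (L * M)) → Fin M
  columnOf v = column (proj₂ (remQuot {nV A} (L * M) v))

  columnOf-combine : ∀ (x : Fin (nV A)) p → columnOf (combine x p) ≡ column p
  columnOf-combine x p = cong (column ∘ proj₂) (remQuot-combine x p)

  liftOf-columns : ∀ e j {P Q} → liftOf (e , j) ≡ normal P Q →
    columnOf P ≡ column (tailPos (edge A e) j) × columnOf Q ≡ column (tailPos (edge A e) j) ⊕ shift e
  liftOf-columns e j refl =
    columnOf-combine _ _ , trans (columnOf-combine _ _) (column-headPos (edge A e) (shift e) j)

  liftOf-nondegenerate : ∀ p {P Q} → liftOf p ≡ normal P Q → P ≢ Q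
  liftOf-nondegenerate (e , j) eq refl with liftOf-columns e j eq
  ... | tail , head = ⊕-fixedPointFree _ (s≤s z≤n) (shift<M e) (trans (sym head) tail)

  liftOf-same-edge : ∀ e j e′ j′ → liftOf (e , j) ≡ liftOf (e′ , j′) → e ≡ e′
  liftOf-same-edge e j e′ j′ eq = shift-injective (⊕-cancelˡ c (shift<M e) (shift<M e′) (begin
    c ⊕ shift e     ≡⟨ proj₂ cols ⟨
    columnOf H′     ≡⟨ proj₂ cols′ ⟩
    c′ ⊕ shift e′   ≡⟨ cong (_⊕ shift e′) (trans (sym (proj₁ cols′)) (proj₁ cols)) ⟩
    c ⊕ shift e′    ∎))
    where
    c  = column (tailPos (edge A e) j)
    c′ = column (tailPos (edge A e′) j′)
    H′ = combine (proj₂ (ends (edge A e′))) (headPos (edge A e′) (shift e′) j′)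
    cols  = liftOf-columns e j eq
    cols′ = liftOf-columns e′ j′ refl

  liftOf-injective : ∀ {p p′} → liftOf p ≡ liftOf p′ → p ≡ p′
  liftOf-injective {e , j} {e′ , j′} eq with liftOf-same-edge e j e′ j′ eq
  ... | refl = cong (e ,_) (tailPos-injective (edge A e) (proj₂ (combine-injective x _ x _ same-tail)))
    where
    x = proj₁ (ends (edge A e))
    same-tail = proj₁ (normal-injective eq)

  liftOf-not-reversed : ∀ p p′ {P Q} → liftOf p ≡ normal P Q → liftOf p′ ≡ normal Q P → ⊥
  liftOf-not-reversed (e , j) (e′ , j′) eq eq′ =
    ⊕-fixedPointFree c′ (s≤s z≤n) (shift+shift<M e′ e) (begin
      c′ ⊕ (shift e′ + shift e)  ≡⟨ ⊕-assoc c′ (shift e′) (shift e) ⟨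
      c′ ⊕ shift e′ ⊕ shift e    ≡⟨ cong (_⊕ shift e) (trans (sym (proj₂ cols′)) (proj₁ cols)) ⟩
      c ⊕ shift e                ≡⟨ trans (sym (proj₂ cols)) (proj₁ cols′) ⟩
      c′                         ∎)
    where
    c  = column (tailPos (edge A e) j)
    c′ = column (tailPos (edge A e′) j′)
    cols  = liftOf-columns e j eq
    cols′ = liftOf-columns e′ j′ eq′

  G : Graph
  G = record
    { nV              = nV A * (L * M)
    ; nE              = sumFin (nE A) (lifts ∘ edge A)
    ; edge            = liftOf ∘ toΣ (lifts ∘ edge A)
    ; normal-distinct = λ t _ _ → liftOf-nondegenerate (toΣ (lifts ∘ edge A) t)
    }

  simple : Simple G
  simple = (λ _ _ ()) , (λ _ _ ()) , no-parallel
    where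
    no-parallel : ∀ t t′ P Q → edge G t ≡ normal P Q →
      edge G t′ ≡ normal P Q ⊎ edge G t′ ≡ normal Q P → t ≡ t′
    no-parallel _ _ _ _ eq (inj₁ eq′) = toΣ-injective (lifts ∘ edge A) (liftOf-injective (trans eq (sym eq′)))
    no-parallel _ _ _ _ eq (inj₂ eq′) = ⊥-elim (liftOf-not-reversed _ _ eq eq′)

  base : Fin (nV G) → Fin (nV A)
  base v = proj₁ (remQuot {nV A} (L * M) v)

  base-combine : ∀ (x : Fin (nV A)) p → base (combine x p) ≡ x
  base-combine x p = cong proj₁ (remQuot-combine x p)

  liftOf-over : ∀ e j → Over base (liftOf (e , j)) (edge A e)
  liftOf-over e j with edge A e
  ... | normal x y = inj₁ (base-combine x _ , base-combine y _)
  ... | loop x     = base-combine x _ , base-combine x _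
  ... | semi x     = base-combine x _ , base-combine x _

  edgeOf : Fin (nE G) → Fin (nE A)
  edgeOf = proj₁ ∘ toΣ (lifts ∘ edge A)

  local-bij : LocallyBijective G A base edgeOf
  local-bij v h with combine-surjective {nV A} {L * M} v
  ... | a , q , refl with combine-surjective {L} q
  ... | γ , i , refl = begin
    sumFin (nE G) (λ t → ind (edgeOf t ≟ h) * mult (edge G t) v)
      ≡⟨ sumFin≡∑ (nE G) _ ⟩
    ∑[ t < nE G ] (ind (edgeOf t ≟ h) * mult (edge G t) v)
      ≡⟨ ∑-toΣ (lifts ∘ edge A) (λ (e , j) → ind (e ≟ h) * mult (liftOf (e , j)) v) ⟩
    ∑[ e < nE A ] ∑[ j < lifts (edge A e) ] (ind (e ≟ h) * mult (liftOf (e , j)) v)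
      ≡⟨ sum-cong-≗ (λ e → *-distribˡ-sum (ind (e ≟ h)) (λ j → mult (liftOf (e , j)) v)) ⟨
    ∑[ e < nE A ] (ind (e ≟ h) * ∑[ j < lifts (edge A e) ] mult (liftOf (e , j)) v)
      ≡⟨ ∑-δ h (λ e → ∑[ j < lifts (edge A e) ] mult (liftOf (e , j)) v) ⟩
    ∑[ j < lifts (edge A h) ] mult (liftOf (h , j)) v
      ≡⟨ ∑-mult-liftEdge (edge A h) (shift h) (<⇒≤ (shift<M h)) (semi⇒L′≡1 h) a γ i ⟩
    mult (edge A h) a
      ≡⟨ cong (mult (edge A h)) (base-combine a _) ⟨
    mult (edge A h) (base v)
      ∎

  column₀ : Fin M
  column₀ = fromℕ< (≤-<-trans z≤n 2e<M)

  lift₀ : ∀ E → Fin (lifts E)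
  lift₀ (normal _ _) = combine bottom column₀
  lift₀ (loop _)     = combine bottom column₀
  lift₀ (semi _)     = column₀

  cover : G ⟶ A
  cover = record
    { fV        = base
    ; fE        = edgeOf
    ; fV-surj   = λ x → combine x (combine bottom column₀) , λ eq → trans (cong base eq) (base-combine x _)
    ; fE-surj   = λ e → fromΣ _ (e , lift₀ (edge A e)) ,
                        λ eq → trans (cong edgeOf eq) (cong proj₁ (toΣ-fromΣ (lifts ∘ edge A) _))
    ; deg-pres  = locallyBijective⇒deg-pres G A base edgeOf local-bij
    ; inc-pres  = λ t → liftOf-over (proj₁ (toΣ (lifts ∘ edge A) t)) (proj₂ (toΣ (lifts ∘ edge A) t))
    ; local-bij = local-bij
    }

▷⇒∣layers*nV : ∀ {A B} → Connected B → A ▷ B →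
  ∀ L′ → (∀ e x → edge A e ≡ semi x → L′ ≡ 1) → nV B ∣ nV A * suc L′
▷⇒∣layers*nV {A} {B} conB A▷B L′ semi⇒L′≡1 =
  ∣m+n∣m⇒∣n (subst (nV B ∣_) split (∣cover (suc M) (≤-<-trans (n≤1+n _) (n<1+n M)))) (∣cover M (n<1+n _))
  where
  M : ℕ
  M = suc (nE A + nE A)

  ∣cover : ∀ M → nE A + nE A < M → nV B ∣ nV A * (suc L′ * M)
  ∣cover M 2e<M = nV∣nV-of-covering conB (A▷B G simple cover)
    where open SimpleCover A L′ M 2e<M semi⇒L′≡1

  split : nV A * (suc L′ * suc M) ≡ nV A * (suc L′ * M) + nV A * suc L′
  split = begin
    nV A * (suc L′ * suc M)                 ≡⟨ cong (nV A *_) (*-suc (suc L′) M) ⟩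
    nV A * (suc L′ + suc L′ * M)            ≡⟨ *-distribˡ-+ (nV A) (suc L′) _ ⟩
    nV A * suc L′ + nV A * (suc L′ * M)     ≡⟨ +-comm (nV A * suc L′) _ ⟩
    nV A * (suc L′ * M) + nV A * suc L′     ∎

theorem2 : (A B : Graph) → Connected A → Connected B → A ▷ B →
    (nV B ∣ 2 * nV A) × (NoSemiEdges A → nV B ∣ nV A)
theorem2 A B _ conB A▷B =
    subst (nV B ∣_) (*-comm (nV A) 2) (▷⇒∣layers*nV conB A▷B 1 (λ _ _ _ → refl))
  , λ noSemi → subst (nV B ∣_) (*-identityʳ (nV A))
                 (▷⇒∣layers*nV conB A▷B 0 (λ e x eq → ⊥-elim (noSemi e x eq)))
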